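{- Let $G=G[X,Y]$ be an essentially 4-edge-connected bipartite cubic graph with bipartition $(X,Y)$. Let $x\in X$ and $y\in Y$. Then $G-(N_G[x]\cup N_G[y])$ has a perfect matching.
   Context: $N_G[v]=\{v\}\cup N_G(v)$ is the closed neighbourhood. A 3-connected cubic graph is essentially 4-edge-connected if every edge cut consisting of three edges $\{e_1,e_2,e_3\}$ induces $K_{1,3}$, i.e. consists of the three edges incident with a single vertex. -}

module Defs where

open import Data.Nat using (ℕ; zero; suc; _+_; _≤_)
open import Data.Fin using (Fin)
import Data.Fin as F
open import Data.Bool using (Bool; true; false; _∨_; _∧_; not; if_then_else_)
open import Data.Product using (Σ; ∃; _×_; _,_)
open import Data.Sum using (_⊎_)
open import Relation.Binary.PropositionalEquality using (_≡_; _≢_)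
open import Relation.Nullary using (¬_)
open import Relation.Nullary.Decidable using (⌊_⌋)

record Graph (n : ℕ) : Set where
  field
    adj     : Fin n → Fin n → Bool
    sym     : ∀ u v → adj u v ≡ adj v u
    irrefl  : ∀ v → adj v v ≡ false
open Graph public

VSet : ℕ → Set
VSet n = Fin n → Bool

count : ∀ {n} → (Fin n → Bool) → ℕ
count {zero}  P = 0
count {suc n} P = (if P F.zero then 1 else 0) + count (λ i → P (F.suc i))

sumF : ∀ {n} → (Fin n → ℕ) → ℕ
sumF {zero}  f = 0
sumF {suc n} f = f F.zero + sumF (λ i → f (F.suc i))

count₂ : ∀ {n} → (Fin n → Fin n → Bool) → ℕ
count₂ R = sumF (λ u → count (R u))

degree : ∀ {n} → Graph n → Fin n → ℕ
degree G v = count (adj G v)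

Cubic : ∀ {n} → Graph n → Set
Cubic G = ∀ v → degree G v ≡ 3

data WalkIn {n} (G : Graph n) (S : VSet n) : Fin n → Fin n → Set where
  here : ∀ {v} → S v ≡ true → WalkIn G S v v
  step : ∀ {u v w} → S u ≡ true → adj G u v ≡ true → WalkIn G S v w → WalkIn G S u w

ConnectedAfterDeleting : ∀ {n} → Graph n → VSet n → Set
ConnectedAfterDeleting G D =
  ∀ u w → D u ≡ false → D w ≡ false → WalkIn G (λ v → not (D v)) u w

KConnected : ℕ → ∀ {n} → Graph n → Set
KConnected k {n} G =
  suc k ≤ n × (∀ (D : VSet n) → suc (count D) ≤ k → ConnectedAfterDeleting G D)

cutSize : ∀ {n} → Graph n → VSet n → ℕ
cutSize G S = count₂ (λ u w → S u ∧ not (S w) ∧ adj G u w)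

InCut : ∀ {n} → Graph n → VSet n → Fin n → Fin n → Set
InCut G S u w = adj G u w ≡ true × ((S u ≡ true × S w ≡ false) ⊎ (S u ≡ false × S w ≡ true))

-- A 3-connected cubic graph is essentially 4-edge-connected if every edge cut
-- with three edges consists of the three edges incident with a single vertex.
Essentially4EdgeConnected : ∀ {n} → Graph n → Set
Essentially4EdgeConnected {n} G =
  KConnected 3 G × Cubic G ×
  (∀ (S : VSet n) → cutSize G S ≡ 3 →
     ∃ λ (v : Fin n) → ∀ u w → adj G u w ≡ true →
        (InCut G S u w → (u ≡ v ⊎ w ≡ v)) × ((u ≡ v ⊎ w ≡ v) → InCut G S u w))

-- (X , Y) is a bipartition of G, with X given by the predicate side
-- (side v ≡ true ↔ v ∈ X, Y the complement): every edge joins X and Y.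
IsBipartition : ∀ {n} → Graph n → VSet n → Set
IsBipartition G side = ∀ u w → adj G u w ≡ true → side u ≢ side w

closedNbhd : ∀ {n} → Graph n → Fin n → VSet n
closedNbhd G x v = ⌊ x F.≟ v ⌋ ∨ adj G x v

PerfectMatchingOf : ∀ {n} → Graph n → VSet n → Set
PerfectMatchingOf {n} G R =
  Σ (Fin n → Fin n → Bool) λ M →
    (∀ u w → M u w ≡ M w u) ×
    (∀ u w → M u w ≡ true → adj G u w ≡ true × R u ≡ true × R w ≡ true) ×
    (∀ v → R v ≡ true → count (M v) ≡ 1)

{-# OPTIONS --safe #-}
module Submission where

-- Let Z = N[x] ∪ N[y], L = X ∖ Z and R = Y ∖ Z.  A cubic bipartite graph has |X| = |Y|, and
-- |X ∩ Z| = |{x} ∪ N(y)| = |{y} ∪ N(x)| = |Y ∩ Z|, so |L| = |R|, and by Hall's theorem it suffices that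
-- every A ⊆ L has at least |A| neighbours in R.  If B = N(A) ∩ R were smaller than A, consider
-- W = A ∪ {x} ∪ B ∪ (N(x) ∖ {y}).  All edges at A and all edges at x except xy stay inside W, so
-- counting degrees, |δ(W)| = 3|W| − 2e(W) ≤ 3 + 3(|B| − |A|) + |N(x) ∖ {y}| ≤ |N(x) ∖ {y}| ≤ 3,
-- while |W| ≥ 3 and the complement of W contains N(y) ∖ {x}.  At most two cut edges have at most
-- two ends in W, and a 3-edge cut is the star of one vertex by essential 4-edge-connectivity; either
-- way fewer than three vertices would separate G, contradicting 3-connectivity.

open import Defs hiding (sym)
open import Data.Nat using (ℕ)
open import Data.Fin using (Fin)
open import Data.Bool using (Bool; true; false; not; _∨_)
open import Relation.Binary.PropositionalEquality using (_≡_)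

open import Data.Nat using (zero; suc; _+_; _*_; _≤_; _<_; z≤n; s≤s; s≤s⁻¹; _≤?_; _<?_)
open import Data.Nat.Properties hiding (_≟_)
open import Data.Nat.Tactic.RingSolver using (solve-∀)
open import Algebra.Properties.CommutativeSemigroup +-commutativeSemigroup using (interchange)
open import Data.Fin using (_≟_)
import Data.Fin as F
import Data.Fin.Properties as FinP
open FinP using (any?; all?)
open import Data.Fin.Subset.Properties using (anySubset?)
open import Data.Vec using (lookup; tabulate)
open import Data.Vec.Properties using (lookup∘tabulate)
open import Data.Bool using (_∧_; if_then_else_)
import Data.Bool as B
open import Data.Bool.Properties using (∧-comm; ∧-zeroʳ; ∧-identityʳ; ∨-identityʳ; ∨-comm; ¬-not; not-involutive)
open import Data.Product using (Σ; ∃; _×_; _,_; proj₁; proj₂)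
open import Data.Nat.Induction using (<-rec)
open import Data.Sum using (_⊎_; inj₁; inj₂)
open import Data.Empty using (⊥; ⊥-elim)
open import Function using (id; _∘_)
open import Relation.Nullary using (¬_; Dec; yes; no; contradiction)
open import Relation.Nullary.Decidable using (⌊_⌋; toSum; _×-dec_; _→-dec_; ⌊⌋-map′; isYes≗does; dec-true)
open import Relation.Binary.PropositionalEquality
  using (_≢_; refl; sym; trans; cong; cong₂; subst; subst₂; ≡-≟-identity; ≢-≟-identity; module ≡-Reasoning)

-- Boolean vertex sets and their sizes

ind : Bool → ℕ
ind b = if b then 1 else 0

_⊆_ : ∀ {n} → VSet n → VSet n → Set
P ⊆ Q = ∀ v → P v ≡ true → Q v ≡ true

not≡false⇒≡true : ∀ {b} → not b ≡ false → b ≡ true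
not≡false⇒≡true {true} _ = refl

not≡true⇒≡false : ∀ {b} → not b ≡ true → b ≡ false
not≡true⇒≡false {false} _ = refl

⇒∧≡false : ∀ {a b} → (a ≡ true → b ≡ false) → a ∧ b ≡ false
⇒∧≡false {false} _   = refl
⇒∧≡false {true}  a⇒¬b = a⇒¬b refl

∧-absorbs : ∀ {a b} → (a ≡ true → b ≡ true) → a ∧ b ≡ a
∧-absorbs {false} _   = refl
∧-absorbs {true}  a⇒b = a⇒b refl

ind-∨-∧ : ∀ {a b} c → (a ≡ true → b ≡ false) → ind ((a ∨ b) ∧ c) ≡ ind (a ∧ c) + ind (b ∧ c)
ind-∨-∧ {true}  c a⇒¬b rewrite a⇒¬b refl = sym (+-identityʳ (ind c))
ind-∨-∧ {false} c _ = refl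

nor⁴ : ∀ {p q r s} → not ((p ∨ q) ∨ (r ∨ s)) ≡ true → p ≡ false × q ≡ false × r ≡ false × s ≡ false
nor⁴ {false} {false} {false} {false} _ = refl , refl , refl , refl

¬true⇒false : ∀ {b} → ¬ (b ≡ true) → b ≡ false
¬true⇒false {false} _  = refl
¬true⇒false {true}  ¬b = contradiction refl ¬b

∧-elim : ∀ {a b} → a ∧ b ≡ true → a ≡ true × b ≡ true
∧-elim {true} {true} _ = refl , refl

∧-intro : ∀ {a b} → a ≡ true → b ≡ true → a ∧ b ≡ true
∧-intro refl refl = refl

∨-elim : ∀ {a b} → a ∨ b ≡ true → a ≡ true ⊎ b ≡ true
∨-elim {true}  _ = inj₁ refl
∨-elim {false} b = inj₂ b

∨-introˡ : ∀ {a b} → a ≡ true → a ∨ b ≡ true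
∨-introˡ refl = refl

∨-introʳ : ∀ {a b} → b ≡ true → a ∨ b ≡ true
∨-introʳ {true}  _ = refl
∨-introʳ {false} b = b

⌊≟⌋-refl : ∀ {n} (x : Fin n) → ⌊ x ≟ x ⌋ ≡ true
⌊≟⌋-refl x = cong ⌊_⌋ (≡-≟-identity _≟_ refl)

⌊≟⌋-≢ : ∀ {n} {x v : Fin n} → x ≢ v → ⌊ x ≟ v ⌋ ≡ false
⌊≟⌋-≢ x≢v = cong ⌊_⌋ (≢-≟-identity _≟_ x≢v)

⌊≟⌋-true⇒≡ : ∀ {n} {x v : Fin n} → ⌊ x ≟ v ⌋ ≡ true → x ≡ v
⌊≟⌋-true⇒≡ {x = x} {v} h with x ≟ v
... | yes x≡v = x≡v

not⌊≟⌋⇒≢ : ∀ {n} {x v : Fin n} → not ⌊ x ≟ v ⌋ ≡ true → x ≢ v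
not⌊≟⌋⇒≢ {x = x} h refl = contradiction (trans (sym (cong not (⌊≟⌋-refl x))) h) λ ()

BRel : ℕ → Set
BRel n = Fin n → Fin n → Bool

ind≤1 : ∀ b → ind b ≤ 1
ind≤1 true  = ≤-refl
ind≤1 false = z≤n

sumF-cong : ∀ {n} {f g : Fin n → ℕ} → (∀ i → f i ≡ g i) → sumF f ≡ sumF g
sumF-cong {zero}  f≗g = refl
sumF-cong {suc n} f≗g = cong₂ _+_ (f≗g F.zero) (sumF-cong (λ i → f≗g (F.suc i)))

sumF-+ : ∀ {n} (f g : Fin n → ℕ) → sumF (λ i → f i + g i) ≡ sumF f + sumF g
sumF-+ {zero}  f g = refl
sumF-+ {suc n} f g =
  trans (cong (f F.zero + g F.zero +_) (sumF-+ (λ i → f (F.suc i)) (λ i → g (F.suc i))))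
        (interchange (f F.zero) (g F.zero) _ _)

sumF-zero : ∀ {n} → sumF {n} (λ _ → 0) ≡ 0
sumF-zero {zero}  = refl
sumF-zero {suc n} = sumF-zero {n}

sumF-comm : ∀ {n m} (f : Fin n → Fin m → ℕ) →
  sumF (λ i → sumF (λ j → f i j)) ≡ sumF (λ j → sumF (λ i → f i j))
sumF-comm {zero}  {m} f = sym (sumF-zero {m})
sumF-comm {suc n} {m} f =
  trans (cong (sumF (f F.zero) +_) (sumF-comm (λ i → f (F.suc i))))
        (sym (sumF-+ (f F.zero) (λ j → sumF (λ i → f (F.suc i) j))))

sumF-mono-≤ : ∀ {n} {f g : Fin n → ℕ} → (∀ i → f i ≤ g i) → sumF f ≤ sumF g
sumF-mono-≤ {zero}  f≤g = z≤n
sumF-mono-≤ {suc n} f≤g = +-mono-≤ (f≤g F.zero) (sumF-mono-≤ (λ i → f≤g (F.suc i)))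

sumF-mono-< : ∀ {n} {f g : Fin n → ℕ} → (∀ i → f i ≤ g i) → ∀ k → f k < g k → sumF f < sumF g
sumF-mono-< {suc n} f≤g F.zero    fk<gk = +-mono-<-≤ fk<gk (sumF-mono-≤ (λ i → f≤g (F.suc i)))
sumF-mono-< {suc n} f≤g (F.suc k) fk<gk = +-mono-≤-< (f≤g F.zero) (sumF-mono-< (λ i → f≤g (F.suc i)) k fk<gk)

sumF-≡⇒≡ : ∀ {n} {f g : Fin n → ℕ} → (∀ i → f i ≤ g i) → sumF f ≡ sumF g → ∀ i → f i ≡ g i
sumF-≡⇒≡ f≤g Σf≡Σg i with m≤n⇒m<n∨m≡n (f≤g i)
... | inj₁ fi<gi = contradiction Σf≡Σg (<⇒≢ (sumF-mono-< f≤g i fi<gi))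
... | inj₂ fi≡gi = fi≡gi

count≡sumF : ∀ {n} (P : VSet n) → count P ≡ sumF (λ i → ind (P i))
count≡sumF {zero}  P = refl
count≡sumF {suc n} P = cong (ind (P F.zero) +_) (count≡sumF (λ i → P (F.suc i)))

sumF-ind-* : ∀ {n} (P : VSet n) c → sumF (λ i → ind (P i) * c) ≡ count P * c
sumF-ind-* {zero}  P c = refl
sumF-ind-* {suc n} P c =
  trans (cong (ind (P F.zero) * c +_) (sumF-ind-* (λ i → P (F.suc i)) c))
        (sym (*-distribʳ-+ c (ind (P F.zero)) _))

count-cong : ∀ {n} {P Q : VSet n} → (∀ i → P i ≡ Q i) → count P ≡ count Q
count-cong {P = P} {Q} P≗Q =
  trans (count≡sumF P) (trans (sumF-cong (λ i → cong ind (P≗Q i))) (sym (count≡sumF Q)))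

count-false : ∀ {n} (P : VSet n) → (∀ i → P i ≡ false) → count P ≡ 0
count-false {n} P P≗false = trans (count-cong P≗false) (trans (count≡sumF {n} (λ _ → false)) (sumF-zero {n}))

count-+-pointwise : ∀ {n} {P Q R S : VSet n} →
  (∀ i → ind (P i) + ind (Q i) ≡ ind (R i) + ind (S i)) → count P + count Q ≡ count R + count S
count-+-pointwise {n} {P} {Q} {R} {S} eq = begin
  count P + count Q                                 ≡⟨ cong₂ _+_ (count≡sumF P) (count≡sumF Q) ⟩
  sumF (λ i → ind (P i)) + sumF (λ i → ind (Q i))   ≡⟨ sym (sumF-+ (λ i → ind (P i)) (λ i → ind (Q i))) ⟩
  sumF (λ i → ind (P i) + ind (Q i))                ≡⟨ sumF-cong eq ⟩
  sumF (λ i → ind (R i) + ind (S i))                ≡⟨ sumF-+ (λ i → ind (R i)) (λ i → ind (S i)) ⟩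
  sumF (λ i → ind (R i)) + sumF (λ i → ind (S i))   ≡⟨ sym (cong₂ _+_ (count≡sumF R) (count≡sumF S)) ⟩
  count R + count S                                 ∎
  where open ≡-Reasoning

count-split-pointwise : ∀ {n} {P Q R : VSet n} → (∀ i → ind (P i) ≡ ind (Q i) + ind (R i)) →
  count P ≡ count Q + count R
count-split-pointwise {n} {P} {Q} {R} eq = begin
  count P                                           ≡⟨ count≡sumF P ⟩
  sumF (λ i → ind (P i))                            ≡⟨ sumF-cong eq ⟩
  sumF (λ i → ind (Q i) + ind (R i))                ≡⟨ sumF-+ (λ i → ind (Q i)) (λ i → ind (R i)) ⟩
  sumF (λ i → ind (Q i)) + sumF (λ i → ind (R i))   ≡⟨ sym (cong₂ _+_ (count≡sumF Q) (count≡sumF R)) ⟩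
  count Q + count R                                 ∎
  where open ≡-Reasoning

count₂-split-pointwise : ∀ {n} {P Q R : BRel n} → (∀ u w → ind (P u w) ≡ ind (Q u w) + ind (R u w)) →
  count₂ P ≡ count₂ Q + count₂ R
count₂-split-pointwise {P = P} {Q} {R} eq =
  trans (sumF-cong (λ u → count-split-pointwise (eq u))) (sumF-+ (λ u → count (Q u)) (λ u → count (R u)))

count-∧-split : ∀ {n} (P Q : VSet n) → count P ≡ count (λ i → P i ∧ Q i) + count (λ i → P i ∧ not (Q i))
count-∧-split P Q = count-split-pointwise pointwise
  where
  pointwise : ∀ i → ind (P i) ≡ ind (P i ∧ Q i) + ind (P i ∧ not (Q i))
  pointwise i with P i | Q i
  ... | true  | true  = refl
  ... | true  | false = refl
  ... | false | _     = refl

count-∨-∧ : ∀ {n} (P Q : VSet n) → count (λ i → P i ∨ Q i) + count (λ i → P i ∧ Q i) ≡ count P + count Q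
count-∨-∧ P Q = count-+-pointwise pointwise
  where
  pointwise : ∀ i → ind (P i ∨ Q i) + ind (P i ∧ Q i) ≡ ind (P i) + ind (Q i)
  pointwise i with P i | Q i
  ... | true  | true  = refl
  ... | true  | false = refl
  ... | false | true  = refl
  ... | false | false = refl

count-disjoint-∨ : ∀ {n} (P Q : VSet n) → (∀ i → P i ∧ Q i ≡ false) →
  count (λ i → P i ∨ Q i) ≡ count P + count Q
count-disjoint-∨ P Q disjoint =
  trans (sym (+-identityʳ _))
        (trans (cong (count (λ i → P i ∨ Q i) +_) (sym (count-false _ disjoint))) (count-∨-∧ P Q))

count-const-∧ : ∀ {n} (b : Bool) (Q : VSet n) → count (λ i → b ∧ Q i) ≡ (if b then count Q else 0)
count-const-∧ true  Q = refl
count-const-∧ false Q = count-false (λ i → false ∧ Q i) (λ _ → refl)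

ind-mono : ∀ {p q} → (p ≡ true → q ≡ true) → ind p ≤ ind q
ind-mono {false} _ = z≤n
ind-mono {true}  p⇒q rewrite p⇒q refl = ≤-refl

count-mono : ∀ {n} {P Q : VSet n} → P ⊆ Q → count P ≤ count Q
count-mono {P = P} {Q} P⊆Q =
  subst₂ _≤_ (sym (count≡sumF P)) (sym (count≡sumF Q)) (sumF-mono-≤ (λ i → ind-mono (P⊆Q i)))

count-mono-< : ∀ {n} {P Q : VSet n} → P ⊆ Q → ∀ k → P k ≡ false → Q k ≡ true → count P < count Q
count-mono-< {P = P} {Q} P⊆Q k Pk Qk =
  subst₂ _<_ (sym (count≡sumF P)) (sym (count≡sumF Q))
         (sumF-mono-< (λ i → ind-mono (P⊆Q i)) k (subst₂ (λ p q → ind p < ind q) (sym Pk) (sym Qk) (s≤s z≤n)))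

count-singleton-∧ : ∀ {n} (x : Fin n) (Q : VSet n) → count (λ v → ⌊ x ≟ v ⌋ ∧ Q v) ≡ ind (Q x)
count-singleton-∧ {suc n} F.zero Q =
  trans (cong (ind (Q F.zero) +_) (count-false (λ v → ⌊ F.zero ≟ F.suc v ⌋ ∧ Q (F.suc v)) (λ _ → refl)))
        (+-identityʳ (ind (Q F.zero)))
count-singleton-∧ {suc n} (F.suc x) Q =
  trans (count-cong (λ v → cong (_∧ Q (F.suc v)) (⌊⌋-map′ (cong F.suc) FinP.suc-injective (x ≟ v))))
        (count-singleton-∧ x (λ v → Q (F.suc v)))

count₂-transpose : ∀ {n} (E : BRel n) → count₂ E ≡ count₂ (λ u w → E w u)
count₂-transpose E = begin
  sumF (λ u → count (E u))                   ≡⟨ sumF-cong (λ u → count≡sumF (E u)) ⟩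
  sumF (λ u → sumF (λ w → ind (E u w)))      ≡⟨ sumF-comm (λ u w → ind (E u w)) ⟩
  sumF (λ w → sumF (λ u → ind (E u w)))      ≡⟨ sym (sumF-cong (λ w → count≡sumF (λ u → E u w))) ⟩
  sumF (λ w → count (λ u → E u w))           ∎
  where open ≡-Reasoning

count₂-singleton-∧ : ∀ {n} (x : Fin n) (Q : BRel n) → count₂ (λ u w → ⌊ x ≟ u ⌋ ∧ Q u w) ≡ count (Q x)
count₂-singleton-∧ x Q =
  trans (count₂-transpose (λ u w → ⌊ x ≟ u ⌋ ∧ Q u w))
        (trans (sumF-cong (λ w → count-singleton-∧ x (λ u → Q u w))) (sym (count≡sumF (Q x))))

count-singleton : ∀ {n} (x : Fin n) → count (λ v → ⌊ x ≟ v ⌋) ≡ 1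
count-singleton x = trans (count-cong (λ v → sym (∧-identityʳ ⌊ x ≟ v ⌋))) (count-singleton-∧ x (λ _ → true))

count-remove : ∀ {n} (P : VSet n) {a} → P a ≡ true → count P ≡ suc (count (λ v → P v ∧ not ⌊ a ≟ v ⌋))
count-remove P {a} Pa =
  trans (count-∧-split P (λ v → ⌊ a ≟ v ⌋)) (cong (_+ count (λ v → P v ∧ not ⌊ a ≟ v ⌋)) count-P∧a)
  where
  count-P∧a : count (λ v → P v ∧ ⌊ a ≟ v ⌋) ≡ 1
  count-P∧a = trans (count-cong (λ v → ∧-comm (P v) _)) (trans (count-singleton-∧ a P) (cong ind Pa))

count-≥1 : ∀ {n} (P : VSet n) {a} → P a ≡ true → 1 ≤ count P
count-≥1 P Pa = subst (1 ≤_) (sym (count-remove P Pa)) (s≤s z≤n)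

count-<⇒∃ : ∀ {n} {P Q : VSet n} → count Q < count P → ∃ λ a → P a ≡ true × Q a ≡ false
count-<⇒∃ {P = P} {Q} Q<P with any? (λ a → (P a B.≟ true) ×-dec (Q a B.≟ false))
... | yes witness = witness
... | no none = contradiction (count-mono P⊆Q) (<⇒≱ Q<P)
  where
  P⊆Q : P ⊆ Q
  P⊆Q a Pa with Q a in Qa
  ... | true  = refl
  ... | false = ⊥-elim (none (a , Pa , Qa))

count-≥1⇒∃ : ∀ {n} (P : VSet n) → 1 ≤ count P → ∃ λ a → P a ≡ true
count-≥1⇒∃ {n} P 1≤P
  with count-<⇒∃ {Q = λ _ → false} (subst (_< count P) (sym (count-false {n} _ (λ _ → refl))) 1≤P)
... | a , Pa , _ = a , Pa

count-≥2⇒∃₂ : ∀ {n} (P : VSet n) → 2 ≤ count P → ∃ λ a → ∃ λ b → a ≢ b × P a ≡ true × P b ≡ true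
count-≥2⇒∃₂ P 2≤P with count-≥1⇒∃ P (≤-trans (s≤s z≤n) 2≤P)
... | a , Pa with count-≥1⇒∃ (λ v → P v ∧ not ⌊ a ≟ v ⌋) (s≤s⁻¹ (subst (2 ≤_) (count-remove P Pa) 2≤P))
... | b , Pb∧b≢a = a , b , a≢b , Pa , proj₁ (∧-elim Pb∧b≢a)
  where
  a≢b : a ≢ b
  a≢b = not⌊≟⌋⇒≢ (proj₂ (∧-elim {P b} Pb∧b≢a))

count-≤1⇒unique : ∀ {n} (P : VSet n) → count P ≤ 1 → ∀ {a b} → P a ≡ true → P b ≡ true → a ≡ b
count-≤1⇒unique P P≤1 {a} {b} Pa Pb with a ≟ b
... | yes a≡b = a≡b
... | no  a≢b = contradiction P≤1 (<⇒≱ (subst (1 <_) (sym (count-remove P Pa)) (s≤s 1≤rest)))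
  where
  1≤rest : 1 ≤ count (λ v → P v ∧ not ⌊ a ≟ v ⌋)
  1≤rest = count-≥1 (λ v → P v ∧ not ⌊ a ≟ v ⌋) (∧-intro Pb (cong not (⌊≟⌋-≢ a≢b)))

-- Hall's theorem

neighbours : ∀ {n} → BRel n → VSet n → VSet n
neighbours E A w = ⌊ any? (λ u → A u ∧ E u w B.≟ true) ⌋

neighbours-intro : ∀ {n} {E : BRel n} {A u w} → A u ≡ true → E u w ≡ true → neighbours E A w ≡ true
neighbours-intro {E = E} {A} {u} {w} Au Euw =
  trans (isYes≗does (any? _)) (dec-true (any? (λ v → A v ∧ E v w B.≟ true)) (u , ∧-intro Au Euw))

neighbours-elim : ∀ {n} {E : BRel n} {A w} → neighbours E A w ≡ true → ∃ λ u → A u ≡ true × E u w ≡ true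
neighbours-elim {E = E} {A} {w} h with any? (λ u → A u ∧ E u w B.≟ true)
... | yes (u , Au∧Euw) = u , ∧-elim Au∧Euw

neighbours-mono : ∀ {n} {E E′ : BRel n} {A A′} → A ⊆ A′ → (∀ u w → E u w ≡ true → E′ u w ≡ true) →
  neighbours E A ⊆ neighbours E′ A′
neighbours-mono {E = E} {E′} {A} {A′} A⊆A′ E⊆E′ w h with neighbours-elim {E = E} {A} h
... | u , Au , Euw = neighbours-intro {E = E′} {A′} (A⊆A′ u Au) (E⊆E′ u w Euw)

HallCondition : ∀ {n} → VSet n → BRel n → Set
HallCondition L E = ∀ A → A ⊆ L → count A ≤ count (neighbours E A)

Deficient : ∀ {n} → VSet n → BRel n → VSet n → Set
Deficient L E A = A ⊆ L × count (neighbours E A) < count A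

-- Decided by enumerating all subsets; hall-theorem uses this to choose which edge to remove.
hallCondition? : ∀ {n} (L : VSet n) (E : BRel n) → HallCondition L E ⊎ ∃ (Deficient L E)
hallCondition? L E with anySubset? (λ s → deficient? (lookup s))
  where
  deficient? : ∀ A → Dec (Deficient L E A)
  deficient? A = all? (λ v → (A v B.≟ true) →-dec (L v B.≟ true)) ×-dec (_ <? _)
... | yes (s , deficient) = inj₂ (lookup s , deficient)
... | no none = inj₁ λ A A⊆L → ≮⇒≥ λ N<A → none (tabulate A , A′⊆L A A⊆L , A′-deficient A N<A)
  where
  A′⊆A : ∀ A → lookup (tabulate A) ⊆ A
  A′⊆A A v = trans (sym (lookup∘tabulate A v))
  A′⊆L : ∀ A → A ⊆ L → lookup (tabulate A) ⊆ L
  A′⊆L A A⊆L v = A⊆L v ∘ A′⊆A A v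
  A′-deficient : ∀ A → count (neighbours E A) < count A →
    count (neighbours E (lookup (tabulate A))) < count (lookup (tabulate A))
  A′-deficient A N<A =
    ≤-<-trans (count-mono (neighbours-mono (A′⊆A A) (λ _ _ → id)))
              (subst (count (neighbours E A) <_) (sym (count-cong (lookup∘tabulate A))) N<A)

removeEdge : ∀ {n} → BRel n → Fin n → Fin n → BRel n
removeEdge E a b u w = E u w ∧ not (⌊ a ≟ u ⌋ ∧ ⌊ b ≟ w ⌋)

removeEdge-⊆ : ∀ {n} (E : BRel n) a b u w → removeEdge E a b u w ≡ true → E u w ≡ true
removeEdge-⊆ E a b u w h = proj₁ (∧-elim {E u w} h)

removeEdge-≢ˡ : ∀ {n} (E : BRel n) {a b u w} → a ≢ u → removeEdge E a b u w ≡ E u w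
removeEdge-≢ˡ E {u = u} {w} a≢u rewrite ⌊≟⌋-≢ a≢u = ∧-identityʳ (E u w)

removeEdge-≢ʳ : ∀ {n} (E : BRel n) {a b u w} → b ≢ w → removeEdge E a b u w ≡ E u w
removeEdge-≢ʳ E {a} {u = u} {w} b≢w rewrite ⌊≟⌋-≢ b≢w | ∧-zeroʳ ⌊ a ≟ u ⌋ = ∧-identityʳ (E u w)

count₂-removeEdge-< : ∀ {n} (E : BRel n) {a b} → E a b ≡ true → count₂ (removeEdge E a b) < count₂ E
count₂-removeEdge-< E {a} {b} Eab =
  sumF-mono-< (λ u → count-mono (removeEdge-⊆ E a b u)) a
              (count-mono-< (removeEdge-⊆ E a b a) b removed Eab)
  where
  removed : removeEdge E a b a b ≡ false
  removed rewrite ⌊≟⌋-refl a | ⌊≟⌋-refl b = ∧-zeroʳ (E a b)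

deficient-after-removal-∋ : ∀ {n} {L : VSet n} {E u w A} → HallCondition L E →
  Deficient L (removeEdge E u w) A → A u ≡ true
deficient-after-removal-∋ {L = L} {E} {u} {w} {A} hall (A⊆L , N<A) with A u in Au
... | true  = refl
... | false = contradiction (≤-trans (hall A A⊆L) (count-mono N⊆N′)) (<⇒≱ N<A)
  where
  N⊆N′ : neighbours E A ⊆ neighbours (removeEdge E u w) A
  N⊆N′ w′ h with neighbours-elim {E = E} {A} h
  ... | v , Av , Evw′ = neighbours-intro {E = removeEdge E u w} {A} Av (trans (removeEdge-≢ˡ E u≢v) Evw′)
    where
    u≢v : u ≢ v
    u≢v refl = contradiction (trans (sym Au) Av) λ ()

-- Submodularity of |N(·)| rules out deficient sets on both sides: D = A₁ ∪ A₂ and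
-- C = (A₁ ∩ A₂) ∖ {u} have |D| + |C| = |A₁| + |A₂| − 1 while N(D) ⊆ N₁ ∪ N₂ and N(C) ⊆ N₁ ∩ N₂.
deficient-removals-incompatible : ∀ {n} {L : VSet n} {E u w₁ w₂ A₁ A₂} → HallCondition L E → w₁ ≢ w₂ →
  Deficient L (removeEdge E u w₁) A₁ → Deficient L (removeEdge E u w₂) A₂ → ⊥
deficient-removals-incompatible {n} {L} {E} {u} {w₁} {w₂} {A₁} {A₂} hall w₁≢w₂
                                def₁@(A₁⊆L , N₁<A₁) def₂@(A₂⊆L , N₂<A₂) =
  <-irrefl refl (begin-strict
    count A₁ + count A₂                         ≡⟨ sym (count-∨-∧ A₁ A₂) ⟩
    count D + count (λ v → A₁ v ∧ A₂ v)         ≡⟨ cong (count D +_) (count-remove (λ v → A₁ v ∧ A₂ v) u∈A₁∩A₂) ⟩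
    count D + suc (count C)                     ≡⟨ +-suc (count D) (count C) ⟩
    suc (count D + count C)                     ≤⟨ s≤s (+-mono-≤ (hall D D⊆L) (hall C C⊆L)) ⟩
    suc (count (neighbours E D) + count (neighbours E C))
                                                ≤⟨ s≤s (+-mono-≤ (count-mono N[D]⊆N₁∪N₂) (count-mono N[C]⊆N₁∩N₂)) ⟩
    suc (count (λ w → N₁ w ∨ N₂ w) + count (λ w → N₁ w ∧ N₂ w))
                                                ≡⟨ cong suc (count-∨-∧ N₁ N₂) ⟩
    suc (count N₁ + count N₂)                   <⟨ s≤s (≤-reflexive (sym (+-suc (count N₁) (count N₂)))) ⟩
    suc (count N₁) + suc (count N₂)             ≤⟨ +-mono-≤ N₁<A₁ N₂<A₂ ⟩
    count A₁ + count A₂                         ∎)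
  where
  open ≤-Reasoning
  E₁ = removeEdge E u w₁
  E₂ = removeEdge E u w₂
  N₁ = neighbours E₁ A₁
  N₂ = neighbours E₂ A₂
  D : VSet n
  D v = A₁ v ∨ A₂ v
  C : VSet n
  C v = (A₁ v ∧ A₂ v) ∧ not ⌊ u ≟ v ⌋
  u∈A₁∩A₂ : A₁ u ∧ A₂ u ≡ true
  u∈A₁∩A₂ = ∧-intro (deficient-after-removal-∋ hall def₁) (deficient-after-removal-∋ hall def₂)
  D⊆L : D ⊆ L
  D⊆L v Dv with ∨-elim {A₁ v} Dv
  ... | inj₁ A₁v = A₁⊆L v A₁v
  ... | inj₂ A₂v = A₂⊆L v A₂v
  C⊆L : C ⊆ L
  C⊆L v Cv = A₁⊆L v (proj₁ (∧-elim {A₁ v} (proj₁ (∧-elim {A₁ v ∧ A₂ v} Cv))))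
  N[D]⊆N₁∪N₂ : neighbours E D ⊆ (λ w → N₁ w ∨ N₂ w)
  N[D]⊆N₁∪N₂ w h with neighbours-elim {E = E} {D} h
  ... | v , Dv , Evw with u ≟ v | ∨-elim {A₁ v} Dv
  ... | no u≢v | inj₁ A₁v = ∨-introˡ (neighbours-intro {E = E₁} {A₁} A₁v (trans (removeEdge-≢ˡ E u≢v) Evw))
  ... | no u≢v | inj₂ A₂v = ∨-introʳ (neighbours-intro {E = E₂} {A₂} A₂v (trans (removeEdge-≢ˡ E u≢v) Evw))
  ... | yes refl | _ with toSum (w₁ ≟ w)
  ... | inj₁ refl = ∨-introʳ (neighbours-intro {E = E₂} {A₂} (proj₂ (∧-elim u∈A₁∩A₂))
                                             (trans (removeEdge-≢ʳ E (w₁≢w₂ ∘ sym)) Evw))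
  ... | inj₂ w₁≢w = ∨-introˡ (neighbours-intro {E = E₁} {A₁} (proj₁ (∧-elim u∈A₁∩A₂))
                                             (trans (removeEdge-≢ʳ E w₁≢w) Evw))
  N[C]⊆N₁∩N₂ : neighbours E C ⊆ (λ w → N₁ w ∧ N₂ w)
  N[C]⊆N₁∩N₂ w h with neighbours-elim {E = E} {C} h
  ... | v , Cv , Evw with ∧-elim {A₁ v ∧ A₂ v} Cv
  ... | A₁∩A₂v , v≢u with ∧-elim {A₁ v} A₁∩A₂v
  ... | A₁v , A₂v =
    ∧-intro (neighbours-intro {E = E₁} {A₁} A₁v (trans (removeEdge-≢ˡ E (not⌊≟⌋⇒≢ v≢u)) Evw))
            (neighbours-intro {E = E₂} {A₂} A₂v (trans (removeEdge-≢ˡ E (not⌊≟⌋⇒≢ v≢u)) Evw))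

EdgesBetween : ∀ {n} → VSet n → VSet n → BRel n → Set
EdgesBetween L R E = ∀ u w → E u w ≡ true → L u ≡ true × R w ≡ true

PerfectMatchingBetween : ∀ {n} → VSet n → VSet n → BRel n → Set
PerfectMatchingBetween {n} L R E = Σ (BRel n) λ M →
  (∀ u w → M u w ≡ true → E u w ≡ true) ×
  (∀ u → L u ≡ true → count (M u) ≡ 1) ×
  (∀ w → R w ≡ true → count (λ u → M u w) ≡ 1)

module _ {n} {L R : VSet n} {E : BRel n} (between : EdgesBetween L R E) (hall : HallCondition L E)
         (out≤1 : ∀ u → count (E u) ≤ 1) where

  private
    N[u]⊆E[u] : ∀ u → neighbours E (λ v → ⌊ u ≟ v ⌋) ⊆ E u
    N[u]⊆E[u] u w h with neighbours-elim {E = E} {λ v → ⌊ u ≟ v ⌋} h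
    ... | v , u≡v , Evw rewrite ⌊≟⌋-true⇒≡ u≡v = Evw

  out-degree≡ind : ∀ u → count (E u) ≡ ind (L u)
  out-degree≡ind u with L u in Lu
  ... | false = count-false (E u) λ w → ¬true⇒false (λ Euw → contradiction (trans (sym Lu) (proj₁ (between u w Euw))) λ ())
  ... | true  = ≤-antisym (out≤1 u) (begin
    1                                          ≡⟨ sym (count-singleton u) ⟩
    count (λ v → ⌊ u ≟ v ⌋)                    ≤⟨ hall _ (λ v u≡v → subst (λ v → L v ≡ true) (⌊≟⌋-true⇒≡ u≡v) Lu) ⟩
    count (neighbours E (λ v → ⌊ u ≟ v ⌋))     ≤⟨ count-mono (N[u]⊆E[u] u) ⟩
    count (E u)                                ∎)
    where open ≤-Reasoning

  in-degree≤1 : ∀ w → count (λ u → E u w) ≤ 1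
  in-degree≤1 w with 2 ≤? count (λ u → E u w)
  ... | no  ≱2 = s≤s⁻¹ (≰⇒> ≱2)
  ... | yes ≥2 with count-≥2⇒∃₂ (λ u → E u w) ≥2
  ... | u₁ , u₂ , u₁≢u₂ , Eu₁w , Eu₂w = contradiction (hall A A⊆L) (<⇒≱ (begin-strict
    count (neighbours E A)     ≤⟨ count-mono N[A]⊆w ⟩
    count (λ v → ⌊ w ≟ v ⌋)    ≡⟨ count-singleton w ⟩
    1                          <⟨ s≤s (s≤s z≤n) ⟩
    2                          ≡⟨ sym count-A ⟩
    count A                    ∎))
    where
    open ≤-Reasoning
    A : VSet n
    A v = ⌊ u₁ ≟ v ⌋ ∨ ⌊ u₂ ≟ v ⌋
    A→w : ∀ v → A v ≡ true → E v w ≡ true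
    A→w v Av with ∨-elim {⌊ u₁ ≟ v ⌋} Av
    ... | inj₁ u₁≡v rewrite ⌊≟⌋-true⇒≡ u₁≡v = Eu₁w
    ... | inj₂ u₂≡v rewrite ⌊≟⌋-true⇒≡ u₂≡v = Eu₂w
    A⊆L : A ⊆ L
    A⊆L v Av = proj₁ (between v w (A→w v Av))
    N[A]⊆w : neighbours E A ⊆ (λ v → ⌊ w ≟ v ⌋)
    N[A]⊆w w′ h with neighbours-elim {E = E} {A} h
    ... | v , Av , Evw′ rewrite count-≤1⇒unique (E v) (out≤1 v) (A→w v Av) Evw′ = ⌊≟⌋-refl w′
    count-A : count A ≡ 2
    count-A = trans (count-disjoint-∨ _ _ disjoint) (cong₂ _+_ (count-singleton u₁) (count-singleton u₂))
      where
      disjoint : ∀ v → ⌊ u₁ ≟ v ⌋ ∧ ⌊ u₂ ≟ v ⌋ ≡ false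
      disjoint v = ¬true⇒false λ both →
        u₁≢u₂ (trans (⌊≟⌋-true⇒≡ (proj₁ (∧-elim both)))
                     (sym (⌊≟⌋-true⇒≡ (proj₂ (∧-elim {⌊ u₁ ≟ v ⌋} both)))))

  hall-functional : count L ≡ count R → PerfectMatchingBetween L R E
  hall-functional balanced = E , (λ _ _ → id) , rows , columns
    where
    rows : ∀ u → L u ≡ true → count (E u) ≡ 1
    rows u Lu = trans (out-degree≡ind u) (cong ind Lu)
    in-degree≤ind : ∀ w → count (λ u → E u w) ≤ ind (R w)
    in-degree≤ind w with R w in Rw
    ... | true  = in-degree≤1 w
    ... | false = ≤-reflexive (count-false (λ u → E u w) λ u → ¬true⇒false λ Euw →
                                 contradiction (trans (sym Rw) (proj₂ (between u w Euw))) λ ())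
    total : sumF (λ w → count (λ u → E u w)) ≡ sumF (λ w → ind (R w))
    total = begin
      sumF (λ w → count (λ u → E u w))  ≡⟨ sym (count₂-transpose E) ⟩
      sumF (λ u → count (E u))          ≡⟨ sumF-cong out-degree≡ind ⟩
      sumF (λ u → ind (L u))            ≡⟨ sym (count≡sumF L) ⟩
      count L                           ≡⟨ balanced ⟩
      count R                           ≡⟨ count≡sumF R ⟩
      sumF (λ w → ind (R w))            ∎
      where open ≡-Reasoning
    columns : ∀ w → R w ≡ true → count (λ u → E u w) ≡ 1
    columns w Rw = trans (sumF-≡⇒≡ in-degree≤ind total w) (cong ind Rw)

perfectMatchingBetween-mono : ∀ {n} {L R : VSet n} {E E′ : BRel n} → (∀ u w → E′ u w ≡ true → E u w ≡ true) →
  PerfectMatchingBetween L R E′ → PerfectMatchingBetween L R E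
perfectMatchingBetween-mono E′⊆E (M , M⊆E′ , rows , columns) =
  M , (λ u w → E′⊆E u w ∘ M⊆E′ u w) , rows , columns

-- Induction on the number of edges: by deficient-removals-incompatible a left vertex with two
-- edges can lose one of them without breaking Hall's condition, until E itself is a matching.
hall-theorem : ∀ {n} {L R : VSet n} {E : BRel n} → EdgesBetween L R E → count L ≡ count R →
  HallCondition L E → PerfectMatchingBetween L R E
hall-theorem {n} {L} {R} {E} = <-rec Goal induction-step (count₂ E) refl
  where
  Goal : ℕ → Set
  Goal m = ∀ {E : BRel n} → count₂ E ≡ m → EdgesBetween L R E → count L ≡ count R →
           HallCondition L E → PerfectMatchingBetween L R E
  remove-edge : ∀ {E : BRel n} → (∀ {k} → k < count₂ E → Goal k) → EdgesBetween L R E → count L ≡ count R →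
    ∀ {u w} → E u w ≡ true → HallCondition L (removeEdge E u w) → PerfectMatchingBetween L R E
  remove-edge {E} smaller between balanced {u} {w} Euw hallE′ =
    perfectMatchingBetween-mono (removeEdge-⊆ E u w)
      (smaller (count₂-removeEdge-< E Euw) refl (λ u′ w′ → between u′ w′ ∘ removeEdge-⊆ E u w u′ w′)
               balanced hallE′)
  induction-step : ∀ m → (∀ {k} → k < m → Goal k) → Goal m
  induction-step m smaller {E} refl between balanced hallE with any? (λ u → 2 ≤? count (E u))
  ... | no  none = hall-functional between hallE (λ u → s≤s⁻¹ (≰⇒> (none ∘ (u ,_)))) balanced
  ... | yes (u , 2≤deg) with count-≥2⇒∃₂ (E u) 2≤deg
  ... | w₁ , w₂ , w₁≢w₂ , Euw₁ , Euw₂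
      with hallCondition? L (removeEdge E u w₁) | hallCondition? L (removeEdge E u w₂)
  ... | inj₁ hall₁ | _         = remove-edge smaller between balanced Euw₁ hall₁
  ... | inj₂ _     | inj₁ hall₂ = remove-edge smaller between balanced Euw₂ hall₂
  ... | inj₂ (_ , def₁) | inj₂ (_ , def₂) = ⊥-elim (deficient-removals-incompatible hallE w₁≢w₂ def₁ def₂)

-- Cubic bipartite graphs

count₂-∧-adj : ∀ {n} (G : Graph n) → Cubic G → ∀ (P : VSet n) → count₂ (λ u w → P u ∧ adj G u w) ≡ count P * 3
count₂-∧-adj G cubic P =
  trans (sumF-cong (λ u → trans (count-const-∧ (P u) (adj G u)) (row u (P u)))) (sumF-ind-* P 3)
  where
  row : ∀ u b → (if b then count (adj G u) else 0) ≡ ind b * 3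
  row u true  = cubic u
  row u false = refl

bipartite-adj : ∀ {n} (G : Graph n) {side} → IsBipartition G side → ∀ {u w} → adj G u w ≡ true → side w ≡ not (side u)
bipartite-adj G bip {u} {w} Guw = ¬-not (bip u w Guw ∘ sym)

bipartite-same-side : ∀ {n} (G : Graph n) {side} → IsBipartition G side → ∀ {u w} → side u ≡ side w → adj G u w ≡ false
bipartite-same-side G bip {u} {w} su≡sw = ¬true⇒false (λ Guw → bip u w Guw su≡sw)

cubic-bipartite-balanced : ∀ {n} {G : Graph n} {side} → Cubic G → IsBipartition G side →
  count side ≡ count (λ v → not (side v))
cubic-bipartite-balanced {G = G} {side} cubic bip = *-cancelʳ-≡ (count side) (count (λ v → not (side v))) 3 (begin
  count side * 3                                          ≡⟨ sym (count₂-∧-adj G cubic side) ⟩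
  count₂ (λ u w → side u ∧ adj G u w)                     ≡⟨ count₂-transpose (λ u w → side u ∧ adj G u w) ⟩
  count₂ (λ u w → side w ∧ adj G w u)                     ≡⟨ sumF-cong (λ u → count-cong (flip-side u)) ⟩
  count₂ (λ u w → not (side u) ∧ adj G u w)               ≡⟨ count₂-∧-adj G cubic (λ v → not (side v)) ⟩
  count (λ v → not (side v)) * 3                          ∎)
  where
  open ≡-Reasoning
  flip-side : ∀ u w → side w ∧ adj G w u ≡ not (side u) ∧ adj G u w
  flip-side u w rewrite Graph.sym G w u with adj G u w in Guw
  ... | true  = trans (∧-identityʳ (side w)) (trans (bipartite-adj G bip Guw) (sym (∧-identityʳ (not (side u)))))
  ... | false = trans (∧-zeroʳ (side w)) (sym (∧-zeroʳ (not (side u))))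

innerEdges : ∀ {n} → Graph n → VSet n → ℕ
innerEdges G W = count₂ (λ u w → W u ∧ (adj G u w ∧ W w))

cutSize+innerEdges : ∀ {n} (G : Graph n) → Cubic G → ∀ W → cutSize G W + innerEdges G W ≡ count W * 3
cutSize+innerEdges G cubic W =
  trans (sym (count₂-split-pointwise pointwise)) (count₂-∧-adj G cubic W)
  where
  pointwise : ∀ u w → ind (W u ∧ adj G u w) ≡ ind (W u ∧ not (W w) ∧ adj G u w) + ind (W u ∧ (adj G u w ∧ W w))
  pointwise u w with W u | W w | adj G u w
  ... | false | _     | _     = refl
  ... | true  | true  | false = refl
  ... | true  | false | false = refl
  ... | true  | true  | true  = refl
  ... | true  | false | true  = refl

sideEdges : ∀ {n} → Graph n → VSet n → VSet n → ℕ
sideEdges G side W = count₂ (λ u w → (W u ∧ side u) ∧ (adj G u w ∧ W w))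

innerEdges-bipartite : ∀ {n} (G : Graph n) {side} → IsBipartition G side → ∀ W →
  innerEdges G W ≡ sideEdges G side W + sideEdges G side W
innerEdges-bipartite G {side} bip W = begin
  innerEdges G W                                                            ≡⟨ count₂-split-pointwise by-side ⟩
  sideEdges G side W + count₂ (λ u w → (W u ∧ not (side u)) ∧ (adj G u w ∧ W w))
    ≡⟨ cong (sideEdges G side W +_) (count₂-transpose (λ u w → (W u ∧ not (side u)) ∧ (adj G u w ∧ W w))) ⟩
  sideEdges G side W + count₂ (λ u w → (W w ∧ not (side w)) ∧ (adj G w u ∧ W u))
    ≡⟨ cong (sideEdges G side W +_) (sumF-cong (λ u → count-cong (flip-side u))) ⟩
  sideEdges G side W + sideEdges G side W                                   ∎
  where
  open ≡-Reasoning
  by-side : ∀ u w → ind (W u ∧ (adj G u w ∧ W w)) ≡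
                    ind ((W u ∧ side u) ∧ (adj G u w ∧ W w)) + ind ((W u ∧ not (side u)) ∧ (adj G u w ∧ W w))
  by-side u w with W u | side u | adj G u w ∧ W w
  ... | false | _     | _     = refl
  ... | true  | true  | true  = refl
  ... | true  | true  | false = refl
  ... | true  | false | true  = refl
  ... | true  | false | false = refl
  flip-side : ∀ u w → (W w ∧ not (side w)) ∧ (adj G w u ∧ W u) ≡ (W u ∧ side u) ∧ (adj G u w ∧ W w)
  flip-side u w rewrite Graph.sym G w u with adj G u w in Guw
  ... | false = trans (∧-zeroʳ _) (sym (∧-zeroʳ (W u ∧ side u)))
  ... | true rewrite bipartite-adj G bip Guw | not-involutive (side u) with W u | W w | side u
  ... | true  | true  | _     = refl
  ... | true  | false | true  = refl
  ... | true  | false | false = refl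
  ... | false | true  | true  = refl
  ... | false | true  | false = refl
  ... | false | false | _     = refl

perfectMatchingOf-sides : ∀ {n} (G : Graph n) (side S : VSet n) {E : BRel n} →
  (∀ u w → E u w ≡ true → adj G u w ≡ true) →
  EdgesBetween (λ v → side v ∧ S v) (λ v → not (side v) ∧ S v) E →
  PerfectMatchingBetween (λ v → side v ∧ S v) (λ v → not (side v) ∧ S v) E →
  PerfectMatchingOf G S
perfectMatchingOf-sides {n} G side S {E} E⊆G between (M , M⊆E , rows , columns) =
  M′ , (λ u w → ∨-comm (M u w) (M w u)) , edge , degree-one
  where
  M′ : BRel n
  M′ u w = M u w ∨ M w u
  ends : ∀ u w → M u w ≡ true → (side u ∧ S u) ≡ true × (not (side w) ∧ S w) ≡ true
  ends u w = between u w ∘ M⊆E u w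
  edge : ∀ u w → M′ u w ≡ true → adj G u w ≡ true × S u ≡ true × S w ≡ true
  edge u w h with ∨-elim {M u w} h
  ... | inj₁ Muw = E⊆G u w (M⊆E u w Muw) , proj₂ (∧-elim {side u} (proj₁ (ends u w Muw)))
                                         , proj₂ (∧-elim {not (side w)} (proj₂ (ends u w Muw)))
  ... | inj₂ Mwu = trans (Graph.sym G u w) (E⊆G w u (M⊆E w u Mwu)) , proj₂ (∧-elim {not (side u)} (proj₂ (ends w u Mwu)))
                                                                  , proj₂ (∧-elim {side w} (proj₁ (ends w u Mwu)))
  degree-one : ∀ v → S v ≡ true → count (M′ v) ≡ 1
  degree-one v Sv with side v in sv
  ... | true = trans (count-cong (λ w → trans (cong (M v w ∨_) (no-in w)) (∨-identityʳ (M v w))))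
                     (rows v (∧-intro sv Sv))
    where
    no-in : ∀ w → M w v ≡ false
    no-in w = ¬true⇒false λ Mwv →
      contradiction (trans (sym (cong not sv)) (proj₁ (∧-elim {not (side v)} (proj₂ (ends w v Mwv))))) λ ()
  ... | false = trans (count-cong (λ w → cong (_∨ M w v) (no-out w))) (columns v (∧-intro (cong not sv) Sv))
    where
    no-out : ∀ w → M v w ≡ false
    no-out w = ¬true⇒false λ Mvw →
      contradiction (trans (sym sv) (proj₁ (∧-elim {side v} (proj₁ (ends v w Mvw))))) λ ()

count-singleton-∨-adj : ∀ {n} (G : Graph n) → Cubic G → ∀ p q →
  count (λ v → ⌊ p ≟ v ⌋ ∨ adj G q v) + ind (adj G q p) ≡ 4
count-singleton-∨-adj G cubic p q = begin
  count (λ v → ⌊ p ≟ v ⌋ ∨ adj G q v) + ind (adj G q p)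
    ≡⟨ cong (count (λ v → ⌊ p ≟ v ⌋ ∨ adj G q v) +_) (sym (count-singleton-∧ p (adj G q))) ⟩
  count (λ v → ⌊ p ≟ v ⌋ ∨ adj G q v) + count (λ v → ⌊ p ≟ v ⌋ ∧ adj G q v)
    ≡⟨ count-∨-∧ (λ v → ⌊ p ≟ v ⌋) (adj G q) ⟩
  count (λ v → ⌊ p ≟ v ⌋) + count (adj G q)
    ≡⟨ cong₂ _+_ (count-singleton p) (cubic q) ⟩
  4 ∎
  where open ≡-Reasoning

count-adj-∖ : ∀ {n} (G : Graph n) → Cubic G → ∀ p q →
  count (λ v → adj G p v ∧ not ⌊ q ≟ v ⌋) + ind (adj G p q) ≡ 3
count-adj-∖ G cubic p q = begin
  count (λ v → adj G p v ∧ not ⌊ q ≟ v ⌋) + ind (adj G p q)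
    ≡⟨ +-comm _ (ind (adj G p q)) ⟩
  ind (adj G p q) + count (λ v → adj G p v ∧ not ⌊ q ≟ v ⌋)
    ≡⟨ cong (_+ count (λ v → adj G p v ∧ not ⌊ q ≟ v ⌋)) (sym (count-singleton-∧ q (adj G p))) ⟩
  count (λ v → ⌊ q ≟ v ⌋ ∧ adj G p v) + count (λ v → adj G p v ∧ not ⌊ q ≟ v ⌋)
    ≡⟨ cong (_+ count (λ v → adj G p v ∧ not ⌊ q ≟ v ⌋)) (count-cong (λ v → ∧-comm ⌊ q ≟ v ⌋ (adj G p v))) ⟩
  count (λ v → adj G p v ∧ ⌊ q ≟ v ⌋) + count (λ v → adj G p v ∧ not ⌊ q ≟ v ⌋)
    ≡⟨ sym (count-∧-split (adj G p) (λ v → ⌊ q ≟ v ⌋)) ⟩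
  count (adj G p)
    ≡⟨ cubic p ⟩
  3 ∎
  where open ≡-Reasoning

2≤count-adj-∖ : ∀ {n} (G : Graph n) → Cubic G → ∀ p q → 2 ≤ count (λ v → adj G p v ∧ not ⌊ q ≟ v ⌋)
2≤count-adj-∖ G cubic p q = s≤s⁻¹ (begin
  3                                                           ≡⟨ sym (count-adj-∖ G cubic p q) ⟩
  count (λ v → adj G p v ∧ not ⌊ q ≟ v ⌋) + ind (adj G p q)   ≤⟨ +-monoʳ-≤ _ (ind≤1 (adj G p q)) ⟩
  count (λ v → adj G p v ∧ not ⌊ q ≟ v ⌋) + 1                 ≡⟨ +-comm _ 1 ⟩
  suc (count (λ v → adj G p v ∧ not ⌊ q ≟ v ⌋))               ∎)
  where open ≤-Reasoning

-- Edge cuts and vertex separators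

walkIn-start : ∀ {n} {G : Graph n} {S p q} → WalkIn G S p q → S p ≡ true
walkIn-start (here Sp)     = Sp
walkIn-start (step Sp _ _) = Sp

walkIn-leaves : ∀ {n} {G : Graph n} {S} (W : VSet n) {p q} → WalkIn G S p q → W p ≡ true → W q ≡ false →
  ∃ λ u → ∃ λ w → adj G u w ≡ true × S u ≡ true × S w ≡ true × W u ≡ true × W w ≡ false
walkIn-leaves W (here _) Wp Wq = contradiction (trans (sym Wp) Wq) λ ()
walkIn-leaves W (step {u} {v} Su Guv rest) Wu Wq with W v in Wv
... | true  = walkIn-leaves W rest Wv Wq
... | false = u , v , Guv , Su , walkIn-start rest , Wu , Wv

CoversCut : ∀ {n} → Graph n → VSet n → VSet n → Set
CoversCut G W D = ∀ u w → adj G u w ≡ true → W u ≡ true → W w ≡ false → D u ≡ true ⊎ D w ≡ true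

kConnected-cutCover : ∀ {k n} {G : Graph n} → KConnected k G → ∀ {W D} → count D < k → CoversCut G W D →
  ∀ {p q} → W p ≡ true → D p ≡ false → W q ≡ false → D q ≡ false → ⊥
kConnected-cutCover (_ , connected) {W} {D} D<k covers {p} {q} Wp Dp Wq Dq
  with walkIn-leaves W (connected D D<k p q Dp Dq) Wp Wq
... | u , w , Guw , ¬Du , ¬Dw , Wu , Ww with covers u w Guw Wu Ww
... | inj₁ Du = contradiction (trans (sym (cong not Du)) ¬Du) λ ()
... | inj₂ Dw = contradiction (trans (sym (cong not Dw)) ¬Dw) λ ()

cutBoundary : ∀ {n} → Graph n → VSet n → VSet n
cutBoundary G W v = W v ∧ neighbours (adj G) (λ w → not (W w)) v

cutBoundary-covers : ∀ {n} (G : Graph n) W → CoversCut G W (cutBoundary G W)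
cutBoundary-covers G W u w Guw Wu Ww =
  inj₁ (∧-intro Wu (neighbours-intro {E = adj G} {λ w → not (W w)} (cong not Ww) (trans (Graph.sym G w u) Guw)))

count-≤-sumF : ∀ {n} (P : VSet n) (f : Fin n → ℕ) → (∀ i → P i ≡ true → 1 ≤ f i) → count P ≤ sumF f
count-≤-sumF P f P⇒1≤f = subst (_≤ sumF f) (sym (count≡sumF P)) (sumF-mono-≤ pointwise)
  where
  pointwise : ∀ i → ind (P i) ≤ f i
  pointwise i with P i in Pi
  ... | true  = P⇒1≤f i Pi
  ... | false = z≤n

count-cutBoundary≤cutSize : ∀ {n} (G : Graph n) W → count (cutBoundary G W) ≤ cutSize G W
count-cutBoundary≤cutSize G W = count-≤-sumF (cutBoundary G W) _ λ u ∂u → edge-out u (∧-elim {W u} ∂u)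
  where
  edge-out : ∀ u → W u ≡ true × neighbours (adj G) (λ w → not (W w)) u ≡ true →
    1 ≤ count (λ w → W u ∧ not (W w) ∧ adj G u w)
  edge-out u (Wu , h) with neighbours-elim {E = adj G} {λ w → not (W w)} h
  ... | w , ¬Ww , Gwu =
    count-≥1 (λ w → W u ∧ not (W w) ∧ adj G u w) (∧-intro Wu (∧-intro ¬Ww (trans (Graph.sym G u w) Gwu)))

-- A cut of at most two edges is covered by its ≤ 2 ends in W; a 3-edge cut is trivial, so a
-- single vertex covers it.  Either way a vertex separator of size < 3 would exist.
no-small-cut : ∀ {n} {G : Graph n} → Essentially4EdgeConnected G → ∀ W → cutSize G W ≤ 3 →
  3 ≤ count W → 2 ≤ count (λ v → not (W v)) → ⊥
no-small-cut {G = G} (connected , _ , trivial3Cuts) W cut≤3 3≤W 2≤Wᶜ with cutSize G W ≤? 2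
... | yes cut≤2 with ≤-trans (count-cutBoundary≤cutSize G W) cut≤2
... | ∂W≤2 with count-<⇒∃ {P = W} {Q = cutBoundary G W} (≤-<-trans ∂W≤2 3≤W)
             | count-≥1⇒∃ (λ v → not (W v)) (≤-trans (s≤s z≤n) 2≤Wᶜ)
... | p , Wp , ∂p | q , ¬Wq =
  kConnected-cutCover connected (s≤s ∂W≤2) (cutBoundary-covers G W) Wp ∂p (not≡true⇒≡false ¬Wq)
    (cong (_∧ neighbours (adj G) (λ w → not (W w)) q) (not≡true⇒≡false ¬Wq))
no-small-cut {G = G} (connected , _ , trivial3Cuts) W cut≤3 3≤W 2≤Wᶜ | no cut≰2
  with trivial3Cuts W (≤-antisym cut≤3 (≰⇒> cut≰2))
... | v , δW≡δv with ≤-reflexive (count-singleton v)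
... | v≤1 with count-<⇒∃ {P = W} {Q = λ u → ⌊ v ≟ u ⌋} (≤-<-trans v≤1 (≤-trans (s≤s (s≤s z≤n)) 3≤W))
             | count-<⇒∃ {P = λ u → not (W u)} {Q = λ u → ⌊ v ≟ u ⌋} (≤-<-trans v≤1 2≤Wᶜ)
... | p , Wp , p≢v | q , ¬Wq , q≢v =
  kConnected-cutCover connected (s≤s (≤-trans v≤1 (s≤s z≤n))) covers Wp p≢v (not≡true⇒≡false ¬Wq) q≢v
  where
  covers : CoversCut G W (λ u → ⌊ v ≟ u ⌋)
  covers u w Guw Wu Ww with proj₁ (δW≡δv u w Guw) (Guw , inj₁ (Wu , Ww))
  ... | inj₁ refl = inj₁ (⌊≟⌋-refl u)
  ... | inj₂ refl = inj₂ (⌊≟⌋-refl w)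

-- Removing N[x] ∪ N[y]

-- From c + 2(3a + k) = 3(a + 1 + b + k) and b < a: writing a = 1 + b + d gives c + 3d = k.
cut-arithmetic : ∀ c a b k → c + ((a * 3 + k) + (a * 3 + k)) ≡ (a + 1 + (b + k)) * 3 → b < a → c ≤ k
cut-arithmetic c a b k eq b<a with m≤n⇒∃[o]m+o≡n b<a
... | d , refl = m+n≤o⇒m≤o c (≤-reflexive (+-cancelʳ-≡ (6 + b * 6 + d * 3 + k * 2) (c + d * 3) k
                   (trans (lhs c b d k) (trans eq (rhs b d k)))))
  where
  lhs : ∀ c b d k → c + d * 3 + (6 + b * 6 + d * 3 + k * 2) ≡ c + ((suc b + d) * 3 + k + ((suc b + d) * 3 + k))
  lhs = solve-∀
  rhs : ∀ b d k → (suc b + d + 1 + (b + k)) * 3 ≡ k + (6 + b * 6 + d * 3 + k * 2)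
  rhs = solve-∀

module ClosedNeighbourhoodsRemoved {n} {G : Graph n} {side : VSet n} (ess : Essentially4EdgeConnected G)
  (bip : IsBipartition G side) {x y : Fin n} (sx : side x ≡ true) (sy : side y ≡ false) where

  Z : VSet n
  Z v = closedNbhd G x v ∨ closedNbhd G y v

  Free : VSet n
  Free v = not (Z v)

  L R : VSet n
  L v = side v ∧ Free v
  R v = not (side v) ∧ Free v

  E : BRel n
  E u w = L u ∧ (R w ∧ adj G u w)

  E⊆G : ∀ u w → E u w ≡ true → adj G u w ≡ true
  E⊆G u w h = proj₂ (∧-elim {R w} (proj₂ (∧-elim {L u} h)))

  between : EdgesBetween L R E
  between u w h = proj₁ (∧-elim h) , proj₁ (∧-elim {R w} (proj₂ (∧-elim {L u} h)))

  private
    cubic : Cubic G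
    cubic = proj₁ (proj₂ ess)

    free-parts : ∀ {v} → Free v ≡ true →
      ⌊ x ≟ v ⌋ ≡ false × adj G x v ≡ false × ⌊ y ≟ v ⌋ ≡ false × adj G y v ≡ false
    free-parts {v} = nor⁴ {⌊ x ≟ v ⌋} {adj G x v} {⌊ y ≟ v ⌋} {adj G y v}

    ⌊≟⌋-sides : ∀ {u v} → side u ≢ side v → ⌊ u ≟ v ⌋ ≡ false
    ⌊≟⌋-sides su≢sv = ⌊≟⌋-≢ (su≢sv ∘ cong side)

    Z-on-X : ∀ v → side v ∧ Z v ≡ ⌊ x ≟ v ⌋ ∨ adj G y v
    Z-on-X v with side v in sv
    ... | true  rewrite bipartite-same-side G bip (trans sx (sym sv))
                      | ⌊≟⌋-sides {y} {v} (λ sy≡sv → contradiction (trans (sym sy) (trans sy≡sv sv)) λ ())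
                      = cong (_∨ adj G y v) (∨-identityʳ ⌊ x ≟ v ⌋)
    ... | false rewrite ⌊≟⌋-sides {x} {v} (λ sx≡sv → contradiction (trans (sym sx) (trans sx≡sv sv)) λ ())
                      | bipartite-same-side G bip (trans sy (sym sv)) = refl

    Z-on-Y : ∀ v → not (side v) ∧ Z v ≡ ⌊ y ≟ v ⌋ ∨ adj G x v
    Z-on-Y v with side v in sv
    ... | false rewrite ⌊≟⌋-sides {x} {v} (λ sx≡sv → contradiction (trans (sym sx) (trans sx≡sv sv)) λ ())
                      | bipartite-same-side G bip (trans sy (sym sv))
                      = trans (cong (adj G x v ∨_) (∨-identityʳ ⌊ y ≟ v ⌋)) (∨-comm (adj G x v) ⌊ y ≟ v ⌋)
    ... | true  rewrite bipartite-same-side G bip (trans sx (sym sv))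
                      | ⌊≟⌋-sides {y} {v} (λ sy≡sv → contradiction (trans (sym sy) (trans sy≡sv sv)) λ ()) = refl

  balanced : count L ≡ count R
  balanced = +-cancelˡ-≡ (count (λ v → side v ∧ Z v)) (count L) (count R) (begin
    count (λ v → side v ∧ Z v) + count L              ≡⟨ sym (count-∧-split side Z) ⟩
    count side                                        ≡⟨ cubic-bipartite-balanced {G = G} cubic bip ⟩
    count (λ v → not (side v))                        ≡⟨ count-∧-split (λ v → not (side v)) Z ⟩
    count (λ v → not (side v) ∧ Z v) + count R        ≡⟨ cong (_+ count R) (sym X∩Z≡Y∩Z) ⟩
    count (λ v → side v ∧ Z v) + count R              ∎)
    where
    open ≡-Reasoning
    X∩Z≡Y∩Z : count (λ v → side v ∧ Z v) ≡ count (λ v → not (side v) ∧ Z v)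
    X∩Z≡Y∩Z = +-cancelʳ-≡ (ind (adj G y x)) _ _ (begin
      count (λ v → side v ∧ Z v) + ind (adj G y x)         ≡⟨ cong (_+ ind (adj G y x)) (count-cong Z-on-X) ⟩
      count (λ v → ⌊ x ≟ v ⌋ ∨ adj G y v) + ind (adj G y x) ≡⟨ count-singleton-∨-adj G cubic x y ⟩
      4                                                    ≡⟨ sym (count-singleton-∨-adj G cubic y x) ⟩
      count (λ v → ⌊ y ≟ v ⌋ ∨ adj G x v) + ind (adj G x y)
        ≡⟨ cong₂ _+_ (sym (count-cong Z-on-Y)) (cong ind (Graph.sym G x y)) ⟩
      count (λ v → not (side v) ∧ Z v) + ind (adj G y x)   ∎)

  private
    module Deficiency (A : VSet n) (A⊆L : A ⊆ L) (B<A : count (neighbours E A) < count A) where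

      B : VSet n
      B = neighbours E A

      N[x]∖y : VSet n
      N[x]∖y v = adj G x v ∧ not ⌊ y ≟ v ⌋

      W : VSet n
      W v = (A v ∨ ⌊ x ≟ v ⌋) ∨ (B v ∨ N[x]∖y v)

      A-side : ∀ {v} → A v ≡ true → side v ≡ true
      A-side {v} Av = proj₁ (∧-elim {side v} (A⊆L v Av))

      A-free : ∀ {v} → A v ≡ true → Free v ≡ true
      A-free {v} Av = proj₂ (∧-elim {side v} (A⊆L v Av))

      B-in-R : ∀ {w} → B w ≡ true → R w ≡ true
      B-in-R {w} Bw with neighbours-elim {E = E} {A} Bw
      ... | u , _ , Euw = proj₁ (∧-elim {R w} (proj₂ (∧-elim {L u} Euw)))

      B-side : ∀ {w} → B w ≡ true → side w ≡ false
      B-side {w} Bw = not≡true⇒≡false (proj₁ (∧-elim {not (side w)} (B-in-R Bw)))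

      B-free : ∀ {w} → B w ≡ true → Free w ≡ true
      B-free {w} Bw = proj₂ (∧-elim {not (side w)} (B-in-R Bw))

      X-part-side : ∀ {v} → A v ∨ ⌊ x ≟ v ⌋ ≡ true → side v ≡ true
      X-part-side {v} h with ∨-elim {A v} h
      ... | inj₁ Av  = A-side Av
      ... | inj₂ x≡v = subst (λ u → side u ≡ true) (⌊≟⌋-true⇒≡ x≡v) sx

      Y-part-side : ∀ {v} → B v ∨ N[x]∖y v ≡ true → side v ≡ false
      Y-part-side {v} h with ∨-elim {B v} h
      ... | inj₁ Bv = B-side Bv
      ... | inj₂ Nv = trans (bipartite-adj G bip (proj₁ (∧-elim {adj G x v} Nv))) (cong not sx)

      W-on-X : ∀ {v} → side v ≡ true → W v ≡ A v ∨ ⌊ x ≟ v ⌋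
      W-on-X {v} sv =
        trans (cong₂ (λ b c → (A v ∨ ⌊ x ≟ v ⌋) ∨ (b ∨ c)) B∌v N∌v) (∨-identityʳ (A v ∨ ⌊ x ≟ v ⌋))
        where
        B∌v : B v ≡ false
        B∌v = ¬true⇒false λ Bv → contradiction (trans (sym sv) (B-side Bv)) λ ()
        N∌v : N[x]∖y v ≡ false
        N∌v = cong (_∧ not ⌊ y ≟ v ⌋) (bipartite-same-side G bip (trans sx (sym sv)))

      A-neighbour-side : ∀ {u w} → A u ≡ true → adj G u w ≡ true → side w ≡ false
      A-neighbour-side Au Guw = trans (bipartite-adj G bip Guw) (cong not (A-side Au))

      A-neighbours-in-W : ∀ {u w} → A u ≡ true → adj G u w ≡ true → B w ∨ N[x]∖y w ≡ true
      A-neighbours-in-W {u} {w} Au Guw with toSum (Free w B.≟ true)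
      ... | inj₁ fw = ∨-introˡ (neighbours-intro {E = E} {A} Au
                                 (∧-intro (A⊆L u Au) (∧-intro (∧-intro (cong not (A-neighbour-side Au Guw)) fw) Guw)))
      ... | inj₂ ¬fw = ∨-introʳ (∧-intro Gxw (cong not (⌊≟⌋-≢ y≢w)))
        where
        y≢w : y ≢ w
        y≢w refl = contradiction
          (trans (sym Guw) (trans (Graph.sym G u y) (proj₂ (proj₂ (proj₂ (free-parts (A-free Au))))))) λ ()
        Gxw : adj G x w ≡ true
        Gxw = trans (cong (_∨ adj G x w) (sym (⌊≟⌋-≢ y≢w)))
                    (trans (sym (Z-on-Y w))
                           (∧-intro (cong not (A-neighbour-side Au Guw)) (not≡false⇒≡true (¬true⇒false ¬fw))))

      x-neighbours-in-W : ∀ w → adj G x w ∧ W w ≡ N[x]∖y w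
      x-neighbours-in-W w with toSum (adj G x w B.≟ true)
      ... | inj₂ ¬Gxw =
        trans (cong (_∧ W w) (¬true⇒false ¬Gxw)) (sym (cong (_∧ not ⌊ y ≟ w ⌋) (¬true⇒false ¬Gxw)))
      ... | inj₁ Gxw =
        trans (cong (adj G x w ∧_) (trans (cong₂ (λ a b → (a ∨ ⌊ x ≟ w ⌋) ∨ (b ∨ N[x]∖y w)) A∌w B∌w)
                                          (cong (λ c → (false ∨ c) ∨ (false ∨ N[x]∖y w)) (⌊≟⌋-≢ x≢w))))
              (cong (_∧ N[x]∖y w) Gxw)
        where
        sw : side w ≡ false
        sw = trans (bipartite-adj G bip Gxw) (cong not sx)
        A∌w : A w ≡ false
        A∌w = ¬true⇒false λ Aw → contradiction (trans (sym (A-side Aw)) sw) λ ()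
        x≢w : x ≢ w
        x≢w x≡w = contradiction (trans (sym sx) (trans (cong side x≡w) sw)) λ ()
        B∌w : B w ≡ false
        B∌w = ¬true⇒false λ Bw → contradiction (trans (sym Gxw) (proj₁ (proj₂ (free-parts (B-free Bw))))) λ ()

      W∧side : ∀ u → W u ∧ side u ≡ A u ∨ ⌊ x ≟ u ⌋
      W∧side u with toSum (side u B.≟ true)
      ... | inj₁ su  = trans (cong (W u ∧_) su) (trans (∧-identityʳ (W u)) (W-on-X su))
      ... | inj₂ ¬su = trans (cong (W u ∧_) (¬true⇒false ¬su))
                             (trans (∧-zeroʳ (W u)) (sym (¬true⇒false (¬su ∘ X-part-side))))

      sideEdges-W : sideEdges G side W ≡ count A * 3 + count N[x]∖y
      sideEdges-W = begin
        sideEdges G side W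
          ≡⟨ sumF-cong (λ u → count-cong (λ w → cong (_∧ (adj G u w ∧ W w)) (W∧side u))) ⟩
        count₂ (λ u w → (A u ∨ ⌊ x ≟ u ⌋) ∧ (adj G u w ∧ W w))
          ≡⟨ count₂-split-pointwise split ⟩
        count₂ (λ u w → A u ∧ adj G u w) + count₂ (λ u w → ⌊ x ≟ u ⌋ ∧ (adj G u w ∧ W w))
          ≡⟨ cong₂ _+_ (count₂-∧-adj G cubic A)
                       (trans (count₂-singleton-∧ x (λ u w → adj G u w ∧ W w)) (count-cong x-neighbours-in-W)) ⟩
        count A * 3 + count N[x]∖y ∎
        where
        open ≡-Reasoning
        split : ∀ u w → ind ((A u ∨ ⌊ x ≟ u ⌋) ∧ (adj G u w ∧ W w)) ≡
                        ind (A u ∧ adj G u w) + ind (⌊ x ≟ u ⌋ ∧ (adj G u w ∧ W w))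
        split u w = trans (ind-∨-∧ (adj G u w ∧ W w) (proj₁ ∘ free-parts ∘ A-free))
                          (cong (λ b → ind b + ind (⌊ x ≟ u ⌋ ∧ (adj G u w ∧ W w))) A∧G∧W≡A∧G)
          where
          A∧G∧W≡A∧G : A u ∧ (adj G u w ∧ W w) ≡ A u ∧ adj G u w
          A∧G∧W≡A∧G with toSum (A u B.≟ true)
          ... | inj₁ Au  = cong (A u ∧_) (∧-absorbs (∨-introʳ {A w ∨ ⌊ x ≟ w ⌋} ∘ A-neighbours-in-W Au))
          ... | inj₂ ¬Au =
            trans (cong (_∧ (adj G u w ∧ W w)) (¬true⇒false ¬Au)) (cong (_∧ adj G u w) (sym (¬true⇒false ¬Au)))

      count-W : count W ≡ count A + 1 + (count B + count N[x]∖y)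
      count-W = begin
        count W
          ≡⟨ count-disjoint-∨ (λ v → A v ∨ ⌊ x ≟ v ⌋) (λ v → B v ∨ N[x]∖y v)
                              (λ v → ⇒∧≡false λ X → ¬true⇒false λ Y →
                                 contradiction (trans (sym (X-part-side X)) (Y-part-side Y)) λ ()) ⟩
        count (λ v → A v ∨ ⌊ x ≟ v ⌋) + count (λ v → B v ∨ N[x]∖y v)
          ≡⟨ cong₂ _+_ (count-disjoint-∨ A (λ v → ⌊ x ≟ v ⌋) (λ v → ⇒∧≡false (proj₁ ∘ free-parts ∘ A-free)))
                       (count-disjoint-∨ B N[x]∖y (λ v → ⇒∧≡false λ Bv →
                           cong (_∧ not ⌊ y ≟ v ⌋) (proj₁ (proj₂ (free-parts (B-free Bv)))))) ⟩
        count A + count (λ v → ⌊ x ≟ v ⌋) + (count B + count N[x]∖y)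
          ≡⟨ cong (λ c → count A + c + (count B + count N[x]∖y)) (count-singleton x) ⟩
        count A + 1 + (count B + count N[x]∖y) ∎
        where open ≡-Reasoning

      cut≤N[x]∖y : cutSize G W ≤ count N[x]∖y
      cut≤N[x]∖y = cut-arithmetic (cutSize G W) (count A) (count B) (count N[x]∖y) (begin
        cutSize G W + (sideEdges-value + sideEdges-value)
          ≡⟨ cong (cutSize G W +_) (sym (trans (innerEdges-bipartite G bip W) (cong₂ _+_ sideEdges-W sideEdges-W))) ⟩
        cutSize G W + innerEdges G W
          ≡⟨ cutSize+innerEdges G cubic W ⟩
        count W * 3
          ≡⟨ cong (_* 3) count-W ⟩
        (count A + 1 + (count B + count N[x]∖y)) * 3 ∎) B<A
        where
        open ≡-Reasoning
        sideEdges-value = count A * 3 + count N[x]∖y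

      N[y]∖x⊆Wᶜ : (λ v → adj G y v ∧ not ⌊ x ≟ v ⌋) ⊆ (λ v → not (W v))
      N[y]∖x⊆Wᶜ v h with ∧-elim {adj G y v} h
      ... | Gyv , x≢v = cong not (trans (W-on-X sv) (cong₂ _∨_ A∌v (not≡true⇒≡false x≢v)))
        where
        sv : side v ≡ true
        sv = trans (bipartite-adj G bip Gyv) (cong not sy)
        A∌v : A v ≡ false
        A∌v = ¬true⇒false λ Av → contradiction (trans (sym Gyv) (proj₂ (proj₂ (proj₂ (free-parts (A-free Av)))))) λ ()

      impossible : ⊥
      impossible = no-small-cut ess W
        (≤-trans cut≤N[x]∖y (m+n≤o⇒m≤o (count N[x]∖y) (≤-reflexive (count-adj-∖ G cubic x y))))
        (begin
          3                                          ≤⟨ s≤s (2≤count-adj-∖ G cubic x y) ⟩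
          1 + count N[x]∖y                            ≤⟨ +-monoˡ-≤ (count N[x]∖y) (m≤n+m 1 (count A)) ⟩
          count A + 1 + count N[x]∖y                  ≤⟨ +-monoʳ-≤ (count A + 1) (m≤n+m (count N[x]∖y) (count B)) ⟩
          count A + 1 + (count B + count N[x]∖y)      ≡⟨ sym count-W ⟩
          count W                                     ∎)
        (≤-trans (2≤count-adj-∖ G cubic y x) (count-mono N[y]∖x⊆Wᶜ))
        where open ≤-Reasoning

  hallCondition : HallCondition L E
  hallCondition A A⊆L = ≮⇒≥ (Deficiency.impossible A A⊆L)

lemma2p12 : ∀ {n} (G : Graph n) (side : Fin n → Bool) →
    Essentially4EdgeConnected G → IsBipartition G side →
    (x y : Fin n) → side x ≡ true → side y ≡ false →
    PerfectMatchingOf G (λ v → not (closedNbhd G x v ∨ closedNbhd G y v))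
lemma2p12 G side ess bip x y sx sy =
  perfectMatchingOf-sides G side Free E⊆G between (hall-theorem between balanced hallCondition)
  where open ClosedNeighbourhoodsRemoved ess bip sx sy
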